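{- Let $G$ be a finite simple graph and let $H \subseteq V(G)$. Then $H$ is $0_2$-invoking in $G$ if and only if $H$ is Complementary Component Dominant (CCD).
   Context: Diffusion on a finite simple graph $G$: a configuration assigns an integer (stack size, possibly negative) $|v|$ to each vertex $v$. Firing a configuration $C$ changes every vertex $v$ simultaneously from $|v|^C$ to $|v|^C + |\{u\in N(v): |u|^C>|v|^C\}| - |\{u\in N(v): |u|^C<|v|^C\}|$ (each vertex sends one chip to each strictly poorer neighbour). The 0-configuration is the one where every vertex has $0$ chips. A perturbation of $H\subseteq V(G)$ (starting from the 0-configuration) is the step in which every vertex of $H$ sends one chip to each of its neighbours in $G$ (regardless of stack sizes); so afterwards each vertex $v$ has stack size $|N(v)\cap H| - (\deg(v)$ if $v\in H$, else $0)$. $H$ is $0_2$-invoking if, starting from the 0-configuration, performing the perturbation of $H$ and then one ordinary Diffusion firing yields the 0-configuration. $H$ is CCD if (i) for all adjacent $x,y\in H$, $x$ and $y$ have the same number of neighbours in $V(G)\setminus H$, and (ii) for all adjacent $u,v\in V(G)\setminus H$, $u$ and $v$ have the same number of neighbours in $H$. -}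

module Defs where

open import Data.Nat using (ℕ; zero; suc)
open import Data.Integer using (ℤ; +_; _-_; _+_; _<?_; 0ℤ)
open import Data.Fin using (Fin)
open import Data.Bool using (Bool; true; false; not; _∧_; if_then_else_; T)
open import Data.List using (List; filter; length)
open import Relation.Binary.PropositionalEquality using (_≡_)
open import Relation.Nullary.Decidable using (⌊_⌋)
open import Data.List.Base using (allFin)

record Graph (n : ℕ) : Set where
  field
    adj   : Fin n → Fin n → Bool
    sym   : ∀ u v → adj u v ≡ adj v u
    irrefl : ∀ v → adj v v ≡ false

open Graph public

VSubset : ℕ → Set
VSubset n = Fin n → Bool

count : ∀ {n} → (Fin n → Bool) → ℕ
count {n} P = length (filter (λ u → T? (P u)) (allFin n))
  where
  open import Data.Bool.Properties using (T?)

Config : ℕ → Set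
Config n = Fin n → ℤ

zeroConfig : ∀ {n} → Config n
zeroConfig _ = 0ℤ

deg : ∀ {n} → Graph n → Fin n → ℕ
deg G v = count (λ u → adj G v u)

nbrsIn : ∀ {n} → Graph n → VSubset n → Fin n → ℕ
nbrsIn G H v = count (λ u → adj G v u ∧ H u)

nbrsOutside : ∀ {n} → Graph n → VSubset n → Fin n → ℕ
nbrsOutside G H v = count (λ u → adj G v u ∧ not (H u))

-- One Diffusion firing: each vertex sends one chip to each strictly poorer neighbour.
fire : ∀ {n} → Graph n → Config n → Config n
fire G C v =
  (C v + + count (λ u → adj G v u ∧ ⌊ C v <? C u ⌋))
    - + count (λ u → adj G v u ∧ ⌊ C u <? C v ⌋)

-- Perturbation of H from the 0-configuration: every vertex of H sends one chip
-- to each of its neighbours.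
perturb : ∀ {n} → Graph n → VSubset n → Config n
perturb G H v = + nbrsIn G H v - (if H v then + deg G v else 0ℤ)

Invoking0₂ : ∀ {n} → Graph n → VSubset n → Set
Invoking0₂ G H = ∀ v → fire G (perturb G H) v ≡ zeroConfig v

CCD : ∀ {n} → Graph n → VSubset n → Set
CCD G H =
  (∀ x y → T (H x) → T (H y) → T (adj G x y) → nbrsOutside G H x ≡ nbrsOutside G H y)
  × (∀ u v → T (not (H u)) → T (not (H v)) → T (adj G u v) → nbrsIn G H u ≡ nbrsIn G H v)
  where open import Data.Product using (_×_)

-- After the perturbation a vertex of H holds minus its number of neighbours outside H and a
-- vertex outside H holds its number of neighbours in H; so every edge across the cut is
-- strictly increasing from H to its complement, and one firing along the cut edges exactly
-- undoes the perturbation. Hence the configuration returns to 0 iff at every vertex the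
-- richer and poorer neighbours on its own side balance. CCD says the stacks are constant
-- along edges inside each side, which clearly gives balance; conversely, under balance a
-- vertex with a poorer neighbour on its side has a richer one, which again has a poorer one,
-- and this strictly ascending chain cannot go on since the stacks are bounded.
module Submission where

open import Defs hiding (sym)
open import Data.Nat using (ℕ)
open import Data.Product using (_×_)

import Data.Nat as ℕ
import Data.Nat.Properties as ℕ
open import Data.Integer using (ℤ; +_; -_; _+_; _-_; _≤_; _<_; _<?_; 0ℤ; ∣_∣; -<+; +≤+)
open import Data.Integer.Properties
  using ( ≤-trans; ≤-reflexive; <⇒≱; <-irrefl; <-asym; <-cmp; +-monoˡ-≤; i<j⇒suc[i]≤j
        ; i≤j⇒0≤j-i; 0≤i⇒+∣i∣≡i; pos-+; +-identityʳ; +-inverseˡ; +-inverseʳ; neg-≤-pos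
        ; +-injective; neg-injective; i-j≡0⇒i≡j; i≡j⇒i-j≡0)
open import Data.Integer.Tactic.RingSolver using (solve-∀)
open import Data.Fin using (Fin)
open import Data.Bool using (Bool; true; false; not; _∧_; if_then_else_; T)
open import Data.Bool.Properties using (T?; T-≡; T-not-≡; T-∧; not-involutive; ∧-zeroʳ)
open import Data.List using (List; []; _∷_; filter; length; allFin)
open import Data.List.Properties using (length-filter; length-tabulate; filter-none; filter-some)
open import Data.List.Relation.Unary.All using (universal)
open import Data.List.Relation.Unary.Any using (here)
open import Data.List.Membership.Propositional using (_∈_; lose)
open import Data.List.Membership.Propositional.Properties using (∈-allFin; ∈-filter⁻)
open import Data.Product using (_,_; proj₂; ∃-syntax)
open import Data.Sum using (_⊎_; inj₁; inj₂)
open import Data.Empty using (⊥-elim)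
open import Data.Unit using (tt)
open import Function.Bundles using (_⇔_; mk⇔; Equivalence)
open import Relation.Binary.PropositionalEquality
  using (_≡_; refl; sym; trans; cong; cong₂; subst; subst₂; module ≡-Reasoning)
open import Relation.Binary.Definitions using (tri<; tri≈; tri>)
open import Relation.Nullary using (¬_)
open import Relation.Nullary.Decidable using (⌊_⌋; toWitness; fromWitness)

open Equivalence using (to; from)

private
  countIn : ∀ {n} → (Fin n → Bool) → List (Fin n) → ℕ
  countIn P xs = length (filter (λ u → T? (P u)) xs)

count-cong : ∀ {n} {P Q : Fin n → Bool} → (∀ u → P u ≡ Q u) → count P ≡ count Q
count-cong {n} {P} {Q} P≡Q = go (allFin n)
  where
  go : ∀ xs → countIn P xs ≡ countIn Q xs
  go []       = refl
  go (x ∷ xs) with P x | Q x | P≡Q x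
  ... | true  | .true  | refl = cong ℕ.suc (go xs)
  ... | false | .false | refl = go xs

count-split : ∀ {n} (P Q : Fin n → Bool) →
              count P ≡ count (λ u → P u ∧ Q u) ℕ.+ count (λ u → P u ∧ not (Q u))
count-split {n} P Q = go (allFin n)
  where
  go : ∀ xs → countIn P xs ≡ countIn (λ u → P u ∧ Q u) xs ℕ.+ countIn (λ u → P u ∧ not (Q u)) xs
  go []       = refl
  go (x ∷ xs) with P x | Q x
  ... | true  | true  = cong ℕ.suc (go xs)
  ... | true  | false = trans (cong ℕ.suc (go xs)) (sym (ℕ.+-suc _ _))
  ... | false | _     = go xs

count-none : ∀ {n} (P : Fin n → Bool) → (∀ u → ¬ T (P u)) → count P ≡ 0
count-none {n} P none = cong length (filter-none (λ u → T? (P u)) (universal none (allFin n)))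

count-pos : ∀ {n} {P : Fin n → Bool} u → T (P u) → 0 ℕ.< count P
count-pos {P = P} u Pu = filter-some (λ u → T? (P u)) (lose (∈-allFin u) Pu)

count-witness : ∀ {n} (P : Fin n → Bool) → 0 ℕ.< count P → ∃[ u ] T (P u)
count-witness {n} P pos with filter (λ u → T? (P u)) (allFin n) in eq
... | []    = ⊥-elim (ℕ.<-irrefl refl pos)
... | u ∷ _ = u , proj₂ (∈-filter⁻ (λ u → T? (P u)) {xs = allFin n} (subst (u ∈_) (sym eq) (here refl)))

count≤n : ∀ {n} (P : Fin n → Bool) → count P ℕ.≤ n
count≤n {n} P = ℕ.≤-trans (length-filter (λ u → T? (P u)) (allFin n))
                          (ℕ.≤-reflexive (length-tabulate (λ u → u)))

T⊎T-not : ∀ x → T x ⊎ T (not x)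
T⊎T-not true  = inj₁ tt
T⊎T-not false = inj₂ tt

T-∧³ : ∀ {a b c} → T ((a ∧ b) ∧ c) ⇔ (T a × T b × T c)
T-∧³ {true}  {true}  {true}  = mk⇔ (λ _ → tt , tt , tt) (λ _ → tt)
T-∧³ {true}  {true}  {false} = mk⇔ (λ ()) (λ { (_ , _ , ()) })
T-∧³ {true}  {false}         = mk⇔ (λ ()) (λ { (_ , () , _) })
T-∧³ {false}                 = mk⇔ (λ ()) (λ { (() , _) })

∧-elim-middle : ∀ {a b c} → (T a → T c → T b) → (a ∧ b) ∧ c ≡ a ∧ c
∧-elim-middle {false}                 _ = refl
∧-elim-middle {true}  {b}     {false} _ = ∧-zeroʳ b
∧-elim-middle {true}  {true}  {true}  _ = refl
∧-elim-middle {true}  {false} {true}  h = ⊥-elim (h tt tt)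

neg-<-pos : ∀ {m n} → 0 ℕ.< m → - (+ m) < + n
neg-<-pos {ℕ.suc m} _ = -<+

module _ {a ℓ} {A : Set a} (f : A → ℤ) {b : ℤ} (f≤b : ∀ x → f x ≤ b)
         {P : A → Set ℓ} (ascend : ∀ {x} → P x → ∃[ y ] P y × f x < f y) where

  private
    -- b ≤ f x + k: at most k further ascents from x stay below the bound.
    unreachable : ∀ k {x} → b ≤ f x + + k → ¬ P x
    unreachable ℕ.zero {x} b≤fx Px with ascend Px
    ... | y , _ , fx<fy =
      <⇒≱ fx<fy (≤-trans (f≤b y) (subst (b ≤_) (+-identityʳ (f x)) b≤fx))
    unreachable (ℕ.suc k) {x} b≤fx+1+k Px with ascend Px
    ... | y , Py , fx<fy = unreachable k (≤-trans b≤fx+1+k fx+1+k≤fy+k) Py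
      where
      shift : ∀ i → i + + ℕ.suc k ≡ (+ 1 + i) + + k
      shift i = trans (cong (λ j → i + j) (pos-+ 1 k)) (shuffle i (+ k))
        where
        shuffle : ∀ i j → i + (+ 1 + j) ≡ (+ 1 + i) + j
        shuffle = solve-∀

      fx+1+k≤fy+k : f x + + ℕ.suc k ≤ f y + + k
      fx+1+k≤fy+k = subst (_≤ f y + + k) (sym (shift (f x))) (+-monoˡ-≤ (+ k) (i<j⇒suc[i]≤j fx<fy))

  bounded-ascending⇒empty : ∀ x → ¬ P x
  bounded-ascending⇒empty x = unreachable ∣ b - f x ∣ (≤-reflexive b≡fx+∣b-fx∣)
    where
    cancel : ∀ i j → i ≡ j + (i - j)
    cancel = solve-∀

    b≡fx+∣b-fx∣ : b ≡ f x + + ∣ b - f x ∣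
    b≡fx+∣b-fx∣ = trans (cancel b (f x))
                        (cong (λ j → f x + j) (sym (0≤i⇒+∣i∣≡i (i≤j⇒0≤j-i (f≤b x)))))

module Perturbation {n : ℕ} (G : Graph n) (H : VSubset n) where

  p : Config n
  p = perturb G H

  adj-sym : ∀ {u v} → T (adj G u v) → T (adj G v u)
  adj-sym {u} {v} = subst T (Graph.sym G u v)

  perturb-inside : ∀ {v} → T (H v) → p v ≡ - (+ nbrsOutside G H v)
  perturb-inside {v} Hv = begin
    + nbrsIn G H v - (if H v then + deg G v else 0ℤ)
      ≡⟨ cong (λ x → + nbrsIn G H v - (if x then + deg G v else 0ℤ)) (to T-≡ Hv) ⟩
    + nbrsIn G H v - + deg G v
      ≡⟨ cong (λ d → + nbrsIn G H v - d)
              (trans (cong +_ (count-split (adj G v) H)) (pos-+ (nbrsIn G H v) (nbrsOutside G H v))) ⟩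
    + nbrsIn G H v - (+ nbrsIn G H v + + nbrsOutside G H v)
      ≡⟨ cancel (+ nbrsIn G H v) (+ nbrsOutside G H v) ⟩
    - (+ nbrsOutside G H v) ∎
    where
    open ≡-Reasoning
    cancel : ∀ i j → i - (i + j) ≡ - j
    cancel = solve-∀

  perturb-outside : ∀ {v} → T (not (H v)) → p v ≡ + nbrsIn G H v
  perturb-outside {v} ¬Hv = begin
    + nbrsIn G H v - (if H v then + deg G v else 0ℤ)
      ≡⟨ cong (λ x → + nbrsIn G H v - (if x then + deg G v else 0ℤ)) (to T-not-≡ ¬Hv) ⟩
    + nbrsIn G H v + 0ℤ
      ≡⟨ +-identityʳ _ ⟩
    + nbrsIn G H v ∎
    where open ≡-Reasoning

  perturb≤n : ∀ v → p v ≤ + n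
  perturb≤n v with T⊎T-not (H v)
  ... | inj₁ Hv  = subst (_≤ + n) (sym (perturb-inside Hv)) neg-≤-pos
  ... | inj₂ ¬Hv = subst (_≤ + n) (sym (perturb-outside ¬Hv)) (+≤+ (count≤n _))

  perturb-cut-< : ∀ {u w} → T (H u) → T (not (H w)) → T (adj G u w) → p u < p w
  perturb-cut-< {u} {w} Hu ¬Hw uw =
    subst₂ _<_ (sym (perturb-inside Hu)) (sym (perturb-outside ¬Hw))
      (neg-<-pos (count-pos w (from T-∧ (uw , ¬Hw))))

  sameSide : Fin n → Fin n → Bool
  sameSide v u = if H v then H u else not (H u)

  sameSide-inside : ∀ {v u} → T (H v) → sameSide v u ≡ H u
  sameSide-inside {v} {u} Hv = cong (λ x → if x then H u else not (H u)) (to T-≡ Hv)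

  sameSide-outside : ∀ {v u} → T (not (H v)) → sameSide v u ≡ not (H u)
  sameSide-outside {v} {u} ¬Hv = cong (λ x → if x then H u else not (H u)) (to T-not-≡ ¬Hv)

  not-sameSide-outside : ∀ {v u} → T (not (H v)) → not (sameSide v u) ≡ H u
  not-sameSide-outside {v} {u} ¬Hv = trans (cong not (sameSide-outside ¬Hv)) (not-involutive (H u))

  sameSide-sym : ∀ {v u} → T (sameSide v u) → T (sameSide u v)
  sameSide-sym {v} {u} s with T⊎T-not (H v)
  ... | inj₁ Hv  = subst T (sym (sameSide-inside (subst T (sameSide-inside Hv) s))) Hv
  ... | inj₂ ¬Hv = subst T (sym (sameSide-outside (subst T (sameSide-outside ¬Hv) s))) ¬Hv

  richer poorer : Fin n → Fin n → Bool
  richer v u = adj G v u ∧ ⌊ p v <? p u ⌋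
  poorer v u = adj G v u ∧ ⌊ p u <? p v ⌋

  alike unlike : (Fin n → Fin n → Bool) → Fin n → ℕ
  alike  R v = count (λ u → R v u ∧ sameSide v u)
  unlike R v = count (λ u → R v u ∧ not (sameSide v u))

  unlike-richer-inside : ∀ {v} → T (H v) → unlike richer v ≡ nbrsOutside G H v
  unlike-richer-inside {v} Hv = count-cong λ u →
    trans (∧-elim-middle λ vu c → fromWitness (perturb-cut-< Hv (subst T (cong not (sameSide-inside Hv)) c) vu))
          (cong (λ x → adj G v u ∧ not x) (sameSide-inside Hv))

  unlike-poorer-inside : ∀ {v} → T (H v) → unlike poorer v ≡ 0
  unlike-poorer-inside {v} Hv = count-none (λ u → poorer v u ∧ not (sameSide v u)) λ u t →
    let vu , u<v , c = to T-∧³ t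
    in <-asym (toWitness u<v) (perturb-cut-< Hv (subst T (cong not (sameSide-inside Hv)) c) vu)

  unlike-richer-outside : ∀ {v} → T (not (H v)) → unlike richer v ≡ 0
  unlike-richer-outside {v} ¬Hv = count-none (λ u → richer v u ∧ not (sameSide v u)) λ u t →
    let vu , v<u , c = to T-∧³ t
    in <-asym (toWitness v<u) (perturb-cut-< (subst T (not-sameSide-outside ¬Hv) c) ¬Hv (adj-sym vu))

  unlike-poorer-outside : ∀ {v} → T (not (H v)) → unlike poorer v ≡ nbrsIn G H v
  unlike-poorer-outside {v} ¬Hv = count-cong λ u →
    trans (∧-elim-middle λ vu c → fromWitness (perturb-cut-< (subst T (not-sameSide-outside ¬Hv) c) ¬Hv (adj-sym vu)))
          (cong (adj G v u ∧_) (not-sameSide-outside ¬Hv))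

  cut-cancels : ∀ v → (p v + + unlike richer v) - + unlike poorer v ≡ 0ℤ
  cut-cancels v with T⊎T-not (H v)
  ... | inj₁ Hv = begin
    (p v + + unlike richer v) - + unlike poorer v
      ≡⟨ cong₂ (λ i j → (i + + j) - + unlike poorer v) (perturb-inside Hv) (unlike-richer-inside Hv) ⟩
    (- (+ nbrsOutside G H v) + + nbrsOutside G H v) - + unlike poorer v
      ≡⟨ cong₂ (λ i j → i - + j) (+-inverseˡ (+ nbrsOutside G H v)) (unlike-poorer-inside Hv) ⟩
    0ℤ ∎
    where open ≡-Reasoning
  ... | inj₂ ¬Hv = begin
    (p v + + unlike richer v) - + unlike poorer v
      ≡⟨ cong₂ (λ i j → (i + + j) - + unlike poorer v) (perturb-outside ¬Hv) (unlike-richer-outside ¬Hv) ⟩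
    (+ nbrsIn G H v + 0ℤ) - + unlike poorer v
      ≡⟨ cong₂ (λ i j → i - + j) (+-identityʳ (+ nbrsIn G H v)) (unlike-poorer-outside ¬Hv) ⟩
    + nbrsIn G H v - + nbrsIn G H v
      ≡⟨ +-inverseʳ (+ nbrsIn G H v) ⟩
    0ℤ ∎
    where open ≡-Reasoning

  fire-perturb : ∀ v → fire G p v ≡ + alike richer v - + alike poorer v
  fire-perturb v = begin
    (p v + + count (richer v)) - + count (poorer v)
      ≡⟨ cong₂ (λ r s → (p v + + r) - + s)
               (count-split (richer v) (sameSide v)) (count-split (poorer v) (sameSide v)) ⟩
    (p v + + (alike richer v ℕ.+ unlike richer v)) - + (alike poorer v ℕ.+ unlike poorer v)
      ≡⟨ cong₂ (λ r s → (p v + r) - s) (pos-+ (alike richer v) (unlike richer v)) (pos-+ (alike poorer v) (unlike poorer v)) ⟩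
    (p v + (+ alike richer v + + unlike richer v)) - (+ alike poorer v + + unlike poorer v)
      ≡⟨ regroup (p v) (+ alike richer v) (+ unlike richer v) (+ alike poorer v) (+ unlike poorer v) ⟩
    (+ alike richer v - + alike poorer v) + ((p v + + unlike richer v) - + unlike poorer v)
      ≡⟨ cong (λ i → (+ alike richer v - + alike poorer v) + i) (cut-cancels v) ⟩
    (+ alike richer v - + alike poorer v) + 0ℤ
      ≡⟨ +-identityʳ _ ⟩
    + alike richer v - + alike poorer v ∎
    where
    open ≡-Reasoning
    regroup : ∀ c r₁ r₂ s₁ s₂ → (c + (r₁ + r₂)) - (s₁ + s₂) ≡ (r₁ - s₁) + ((c + r₂) - s₂)
    regroup = solve-∀

  Balanced : Set
  Balanced = ∀ v → alike richer v ≡ alike poorer v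

  Level : Set
  Level = ∀ u v → T (adj G u v) → T (sameSide u v) → p u ≡ p v

  invoking⇒balanced : Invoking0₂ G H → Balanced
  invoking⇒balanced invoking v =
    +-injective (i-j≡0⇒i≡j _ _ (trans (sym (fire-perturb v)) (invoking v)))

  balanced⇒invoking : Balanced → Invoking0₂ G H
  balanced⇒invoking balanced v = trans (fire-perturb v) (i≡j⇒i-j≡0 (cong +_ (balanced v)))

  level⇒balanced : Level → Balanced
  level⇒balanced level v =
    trans (count-none (λ u → richer v u ∧ sameSide v u) λ u t →
             let vu , v<u , s = to T-∧³ t in <-irrefl (level v u vu s) (toWitness v<u))
          (sym (count-none (λ u → poorer v u ∧ sameSide v u) λ u t →
             let vu , u<v , s = to T-∧³ t in <-irrefl (sym (level v u vu s)) (toWitness u<v)))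

  HasPoorerAlike : Fin n → Set
  HasPoorerAlike v = ∃[ u ] T (adj G v u) × T (sameSide v u) × p u < p v

  ascend : Balanced → ∀ {v} → HasPoorerAlike v → ∃[ w ] HasPoorerAlike w × p v < p w
  ascend balanced {v} (u , vu , s , u<v)
    with count-witness (λ w → richer v w ∧ sameSide v w)
           (subst (0 ℕ.<_) (sym (balanced v)) (count-pos u (from T-∧³ (vu , fromWitness u<v , s))))
  ... | w , t with to T-∧³ t
  ... | vw , v<w , s′ = w , (v , adj-sym vw , sameSide-sym s′ , toWitness v<w) , toWitness v<w

  balanced⇒¬HasPoorerAlike : Balanced → ∀ v → ¬ HasPoorerAlike v
  balanced⇒¬HasPoorerAlike balanced = bounded-ascending⇒empty p perturb≤n (ascend balanced)

  balanced⇒level : Balanced → Level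
  balanced⇒level balanced u v uv s with <-cmp (p u) (p v)
  ... | tri< u<v _ _ = ⊥-elim (balanced⇒¬HasPoorerAlike balanced v (u , adj-sym uv , sameSide-sym s , u<v))
  ... | tri≈ _ u≡v _ = u≡v
  ... | tri> _ _ v<u = ⊥-elim (balanced⇒¬HasPoorerAlike balanced u (v , uv , s , v<u))

  level⇒CCD : Level → CCD G H
  level⇒CCD level = inside , outside
    where
    inside : ∀ x y → T (H x) → T (H y) → T (adj G x y) → nbrsOutside G H x ≡ nbrsOutside G H y
    inside x y Hx Hy xy = +-injective (neg-injective (begin
      - (+ nbrsOutside G H x) ≡⟨ sym (perturb-inside Hx) ⟩
      p x                     ≡⟨ level x y xy (subst T (sym (sameSide-inside Hx)) Hy) ⟩
      p y                     ≡⟨ perturb-inside Hy ⟩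
      - (+ nbrsOutside G H y) ∎))
      where open ≡-Reasoning
    outside : ∀ u v → T (not (H u)) → T (not (H v)) → T (adj G u v) → nbrsIn G H u ≡ nbrsIn G H v
    outside u v ¬Hu ¬Hv uv = +-injective (begin
      + nbrsIn G H u ≡⟨ sym (perturb-outside ¬Hu) ⟩
      p u            ≡⟨ level u v uv (subst T (sym (sameSide-outside ¬Hu)) ¬Hv) ⟩
      p v            ≡⟨ perturb-outside ¬Hv ⟩
      + nbrsIn G H v ∎)
      where open ≡-Reasoning

  CCD⇒level : CCD G H → Level
  CCD⇒level (inside , outside) u v uv s with T⊎T-not (H u)
  ... | inj₁ Hu = begin
    p u                     ≡⟨ perturb-inside Hu ⟩
    - (+ nbrsOutside G H u) ≡⟨ cong (λ k → - (+ k)) (inside u v Hu Hv uv) ⟩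
    - (+ nbrsOutside G H v) ≡⟨ sym (perturb-inside Hv) ⟩
    p v ∎
    where
    open ≡-Reasoning
    Hv : T (H v)
    Hv = subst T (sameSide-inside Hu) s
  ... | inj₂ ¬Hu = begin
    p u            ≡⟨ perturb-outside ¬Hu ⟩
    + nbrsIn G H u ≡⟨ cong +_ (outside u v ¬Hu ¬Hv uv) ⟩
    + nbrsIn G H v ≡⟨ sym (perturb-outside ¬Hv) ⟩
    p v ∎
    where
    open ≡-Reasoning
    ¬Hv : T (not (H v))
    ¬Hv = subst T (sameSide-outside ¬Hu) s

mainTheorem1 : ∀ (n : ℕ) (G : Graph n) (H : VSubset n) →
    (Invoking0₂ G H → CCD G H) × (CCD G H → Invoking0₂ G H)
mainTheorem1 n G H =
    (λ invoking → level⇒CCD (balanced⇒level (invoking⇒balanced invoking)))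
  , (λ ccd → balanced⇒invoking (level⇒balanced (CCD⇒level ccd)))
  where open Perturbation G H
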